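{- For every rational number $t$, define $$a=16t^2(t^4-9),\quad b=(t^4-10t^2+9)(t^4+2t^2+9),\quad c=4t(t^2+3)(t^4-10t^2+9),$$ $$d_{ac}=4t(t^2+3)(t^4-2t^2+9),\quad d_{bc}=(t^4-1)(t^4-81),\quad d_s=t^8+46t^4+81.$$ Then $a^2+c^2=d_{ac}^2$, $b^2+c^2=d_{bc}^2$ and $a^2+b^2+c^2=d_s^2$. Thus these give a nearly-perfect cuboid with edges $a,b,c$ in which all edges, the face diagonals $d_{ac},d_{bc}$ and the space diagonal $d_s$ are rational (only $d_{ab}=\sqrt{a^2+b^2}$ is not guaranteed rational).
   Context: This is the paper's "I parametrization" of nearly-perfect cuboids: cuboids with edges $a,b,c$ where among $a,b,c$, $d_{ab}=\sqrt{a^2+b^2}$, $d_{bc}=\sqrt{b^2+c^2}$, $d_{ac}=\sqrt{a^2+c^2}$, $d_s=\sqrt{a^2+b^2+c^2}$ only the face diagonal $d_{ab}$ may be irrational. -}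

module Defs where

open import Data.Rational using (ℚ; _+_; _*_; _-_; _/_; 0ℚ; 1ℚ)
open import Data.Integer using (+_)
open import Data.Nat using (ℕ)
import Data.Rational as Q

n : ℕ → ℚ
n k = (+ k) / 1

infixr 8 _^_
_^_ : ℚ → ℕ → ℚ
x ^ ℕ.zero = 1ℚ
x ^ ℕ.suc k = x * (x ^ k)

edgeA : ℚ → ℚ
edgeA t = n 16 * t ^ 2 * (t ^ 4 - n 9)

edgeB : ℚ → ℚ
edgeB t = (t ^ 4 - n 10 * t ^ 2 + n 9) * (t ^ 4 + n 2 * t ^ 2 + n 9)

edgeC : ℚ → ℚ
edgeC t = n 4 * t * (t ^ 2 + n 3) * (t ^ 4 - n 10 * t ^ 2 + n 9)

diagAC : ℚ → ℚ
diagAC t = n 4 * t * (t ^ 2 + n 3) * (t ^ 4 - n 2 * t ^ 2 + n 9)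

diagBC : ℚ → ℚ
diagBC t = (t ^ 4 - 1ℚ) * (t ^ 4 - n 81)

diagS : ℚ → ℚ
diagS t = t ^ 8 + n 46 * t ^ 4 + n 81

{-# OPTIONS --safe #-}
module Submission where

open import Defs
open import Data.Rational using (ℚ; _+_; _*_; 1ℚ)
open import Data.Rational.Properties using (+-assoc)
open import Data.Rational.Solver using (module +-*-Solver)
open import Data.Product using (_×_; _,_)
open import Relation.Binary.PropositionalEquality using (_≡_; refl; cong; module ≡-Reasoning)

open +-*-Solver

-- The space
-- diagonal is obtained as the hypotenuse of the right triangle with legs a and d_bc:
-- d_s² - d_bc² = (d_s - d_bc)(d_s + d_bc) = 128 t⁴ · 2 (t⁴ - 9)² = a².

edgeAₚ edgeBₚ edgeCₚ diagACₚ diagBCₚ diagSₚ : Polynomial 1 → Polynomial 1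
edgeAₚ x = con (n 16) :* x :^ 2 :* (x :^ 4 :- con (n 9))
edgeBₚ x = (x :^ 4 :- con (n 10) :* x :^ 2 :+ con (n 9)) :* (x :^ 4 :+ con (n 2) :* x :^ 2 :+ con (n 9))
edgeCₚ x = con (n 4) :* x :* (x :^ 2 :+ con (n 3)) :* (x :^ 4 :- con (n 10) :* x :^ 2 :+ con (n 9))
diagACₚ x = con (n 4) :* x :* (x :^ 2 :+ con (n 3)) :* (x :^ 4 :- con (n 2) :* x :^ 2 :+ con (n 9))
diagBCₚ x = (x :^ 4 :- con 1ℚ) :* (x :^ 4 :- con (n 81))
diagSₚ x = x :^ 8 :+ con (n 46) :* x :^ 4 :+ con (n 81)

edgeA²+edgeC²≡diagAC² : ∀ t → edgeA t ^ 2 + edgeC t ^ 2 ≡ diagAC t ^ 2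
edgeA²+edgeC²≡diagAC² = solve 1 (λ x → edgeAₚ x :^ 2 :+ edgeCₚ x :^ 2 := diagACₚ x :^ 2) refl

edgeB²+edgeC²≡diagBC² : ∀ t → edgeB t ^ 2 + edgeC t ^ 2 ≡ diagBC t ^ 2
edgeB²+edgeC²≡diagBC² = solve 1 (λ x → edgeBₚ x :^ 2 :+ edgeCₚ x :^ 2 := diagBCₚ x :^ 2) refl

edgeA²+diagBC²≡diagS² : ∀ t → edgeA t ^ 2 + diagBC t ^ 2 ≡ diagS t ^ 2
edgeA²+diagBC²≡diagS² = solve 1 (λ x → edgeAₚ x :^ 2 :+ diagBCₚ x :^ 2 := diagSₚ x :^ 2) refl

edgeA²+edgeB²+edgeC²≡diagS² : ∀ t → edgeA t ^ 2 + edgeB t ^ 2 + edgeC t ^ 2 ≡ diagS t ^ 2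
edgeA²+edgeB²+edgeC²≡diagS² t = begin
  edgeA t ^ 2 + edgeB t ^ 2 + edgeC t ^ 2   ≡⟨ +-assoc (edgeA t ^ 2) (edgeB t ^ 2) (edgeC t ^ 2) ⟩
  edgeA t ^ 2 + (edgeB t ^ 2 + edgeC t ^ 2) ≡⟨ cong (edgeA t ^ 2 +_) (edgeB²+edgeC²≡diagBC² t) ⟩
  edgeA t ^ 2 + diagBC t ^ 2                ≡⟨ edgeA²+diagBC²≡diagS² t ⟩
  diagS t ^ 2                               ∎
  where open ≡-Reasoning

mainTheorem3 : (t : ℚ) →
    ((edgeA t ^ 2 + edgeC t ^ 2) ≡ diagAC t ^ 2)
    × ((edgeB t ^ 2 + edgeC t ^ 2) ≡ diagBC t ^ 2)
    × ((edgeA t ^ 2 + edgeB t ^ 2 + edgeC t ^ 2) ≡ diagS t ^ 2)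
mainTheorem3 t =
  edgeA²+edgeC²≡diagAC² t , edgeB²+edgeC²≡diagBC² t , edgeA²+edgeB²+edgeC²≡diagS² t
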